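{- Let $G$ be a finite graph with vertex set $V$ that is lefthanded with respect to a tree order $\leq$ on $V$, with vertices labeled by real numbers $0\leq p_v\leq 1$. For $S\subseteq V$ define \[ \sigma(S):=\sum_{\substack{I\supseteq S\\ I\text{ independent in }G}}(-1)^{|I|-|S|}\prod_{v\in I}p_v,\qquad \Lambda(S):=\sum_{\substack{I\subseteq S\\ I\text{ independent in }G}}(-1)^{|I|}\prod_{v\in I}p_v . \] For $v\in V$ let $D_v:=\{u\in V:u\lneq v\}$ and $F_v:=\{u\in D_v: u\not\sim v\}$. If $\sigma(S)\geq 0$ for all $S\subseteq V$, then $0\leq\Lambda(S)\leq 1$ for all $S\subseteq V$, and furthermore $\Lambda(D_v)\geq p_v\Lambda(F_v)$ for every $v\in V$.
   Context: A tree order is a partial order $\leq$ in which $w\lneq u$ and $w\lneq v$ imply that $u$ and $v$ are comparable. A graph $G$ is lefthanded with respect to a tree order $\leq$ on $V(G)$ if (1) $u\sim v$ implies $u\leq v$ or $v\leq u$, and (2) whenever $w\lneq u\lneq v$ and $v\sim w$, also $v\sim u$. The empty set is independent. -}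

module Defs where

open import Level using (Level; _⊔_; suc)
open import Data.Nat using (ℕ; zero; suc; _∸_)
open import Data.Bool using (Bool; true; false; _∧_; not)
import Data.Bool as Bool
open import Data.Fin using (Fin)
import Data.Fin as Fin
open import Data.Fin.Subset using (Subset; _∈_; _⊆_; ∣_∣; inside; outside)
open import Data.Fin.Subset.Properties using (_∈?_; _⊆?_)
open import Data.Fin.Properties using (all?)
open import Data.List using (List; []; _∷_; _++_; map; filter; foldr)
open import Data.Vec using (Vec; []; _∷_; tabulate)
open import Data.Product using (_×_; ∃)
open import Data.Sum using (_⊎_)
open import Relation.Nullary using (¬_; Dec)
open import Relation.Nullary.Decidable using (_→-dec_; _×-dec_; isYes)
open import Relation.Binary.PropositionalEquality using (_≡_)
open import Relation.Binary.Structures using (IsTotalOrder)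
open import Algebra.Bundles using (CommutativeRing)

record OrderedField (c ℓ₁ ℓ₂ : Level) : Set (Level.suc (c ⊔ ℓ₁ ⊔ ℓ₂)) where
  field
    commutativeRing : CommutativeRing c ℓ₁
  open CommutativeRing commutativeRing public
  infix 4 _≤_
  field
    _≤_          : Carrier → Carrier → Set ℓ₂
    isTotalOrder : IsTotalOrder _≈_ _≤_
    +-mono-≤     : ∀ {x y} z → x ≤ y → x + z ≤ y + z
    *-nonneg     : ∀ {x y} → 0# ≤ x → 0# ≤ y → 0# ≤ x * y
    0≉1          : ¬ (0# ≈ 1#)
    inverse      : ∀ x → ¬ (x ≈ 0#) → ∃ λ y → x * y ≈ 1#

-- Finite simple graphs on vertex set Fin n (adjacency given as a Bool
-- valued relation, i.e. a decidable one; every relation on a finite set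
-- is of this form classically).

record Graph (n : ℕ) : Set where
  field
    adj      : Fin n → Fin n → Bool
    adj-sym  : ∀ u v → adj u v ≡ adj v u
    adj-irr  : ∀ v → adj v v ≡ false

module _ {n : ℕ} (G : Graph n) where
  open Graph G

  _∼_ : Fin n → Fin n → Set
  u ∼ v = adj u v ≡ true

  Independent : Subset n → Set
  Independent I = ∀ u v → u ∈ I → v ∈ I → adj u v ≡ false

  independent? : (I : Subset n) → Dec (Independent I)
  independent? I = all? λ u → all? λ v →
    (u ∈? I) →-dec ((v ∈? I) →-dec (adj u v Bool.≟ false))

record TreeOrder (n : ℕ) : Set where
  field
    le : Fin n → Fin n → Bool

  _≼_ : Fin n → Fin n → Set
  u ≼ v = le u v ≡ true

  _≺_ : Fin n → Fin n → Set
  u ≺ v = u ≼ v × ¬ (u ≡ v)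

  field
    refl'    : ∀ v → v ≼ v
    antisym' : ∀ {u v} → u ≼ v → v ≼ u → u ≡ v
    trans'   : ∀ {u v w} → u ≼ v → v ≼ w → u ≼ w
    tree     : ∀ {w u v} → w ≺ u → w ≺ v → (u ≼ v ⊎ v ≼ u)

  lt : Fin n → Fin n → Bool
  lt u v = le u v ∧ not (isYes (u Fin.≟ v))

record Lefthanded {n : ℕ} (G : Graph n) (T : TreeOrder n) : Set where
  open TreeOrder T
  field
    edges-comparable : ∀ {u v} → _∼_ G u v → (u ≼ v ⊎ v ≼ u)
    lefthanded       : ∀ {w u v} → w ≺ u → u ≺ v → _∼_ G v w → _∼_ G v u

D : ∀ {n} → TreeOrder n → Fin n → Subset n
D T v = tabulate λ u → TreeOrder.lt T u v

F : ∀ {n} → Graph n → TreeOrder n → Fin n → Subset n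
F G T v = tabulate λ u → TreeOrder.lt T u v ∧ not (Graph.adj G u v)

allSubsets : (n : ℕ) → List (Subset n)
allSubsets zero    = [] ∷ []
allSubsets (suc n) = map (outside ∷_) (allSubsets n) ++ map (inside ∷_) (allSubsets n)

module WithField {c ℓ₁ ℓ₂} (K : OrderedField c ℓ₁ ℓ₂) where
  open OrderedField K

  negOnePow : ℕ → Carrier
  negOnePow zero    = 1#
  negOnePow (suc k) = - negOnePow k

  ∑ : List Carrier → Carrier
  ∑ = foldr _+_ 0#

  ∏ : ∀ {n} → (Fin n → Carrier) → Subset n → Carrier
  ∏ {zero}  p []            = 1#
  ∏ {suc n} p (true  ∷ I)   = p Fin.zero * ∏ (λ i → p (Fin.suc i)) I
  ∏ {suc n} p (false ∷ I)   = ∏ (λ i → p (Fin.suc i)) I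

  σ : ∀ {n} → Graph n → (Fin n → Carrier) → Subset n → Carrier
  σ {n} G p S =
    ∑ (map (λ I → negOnePow (∣ I ∣ ∸ ∣ S ∣) * ∏ p I)
           (filter (λ I → (S ⊆? I) ×-dec independent? G I) (allSubsets n)))

  Λ : ∀ {n} → Graph n → (Fin n → Carrier) → Subset n → Carrier
  Λ {n} G p S =
    ∑ (map (λ I → negOnePow ∣ I ∣ * ∏ p I)
           (filter (λ I → (I ⊆? S) ×-dec independent? G I) (allSubsets n)))

module Submission where

open import Defs
open import Data.Nat using (ℕ)
open import Data.Fin using (Fin)
open import Data.Fin.Subset using (Subset)
open import Data.Product using (_×_)

import Data.Nat as Nat
open import Data.Nat using (zero; suc; _∸_)
open import Data.Bool using (Bool; true; false; _∧_; not; if_then_else_)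
open import Data.Bool.Properties using (∧-zeroʳ)
open import Data.Fin using (zero; suc) renaming (_≟_ to _≟ᶠ_)
open import Data.Fin.Subset using (inside; outside; _∈_; _∉_; _⊆_; ∁; ⊥; ∣_∣)
open import Data.Fin.Subset.Properties
  using (_∈?_; _⊆?_; ∉⊥; ⊥⊆; ∣⊥∣≡0; p⊆q⇒∣p∣≤∣q∣; x∈∁p⇒x∉p; x∉p⇒x∈∁p)
open import Data.List using (List; []; _∷_; _++_; map; filter)
open import Data.Vec using ([]; _∷_; tabulate; _[_]≔_; here; there)
open import Data.Vec.Properties using ([]=⇒lookup; lookup⇒[]=; lookup∘tabulate)
open import Data.Product using (_,_; proj₁; proj₂)
open import Data.Sum using (_⊎_; inj₁; inj₂)
open import Function using (_∘_; _⇔_; mk⇔; Equivalence)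
open import Relation.Nullary using (Dec; yes; no; does; contradiction)
open import Relation.Nullary.Decidable using (dec-true; dec-false; does-⇔; isYes; isYes≗does; _×-dec_)
open import Relation.Binary.PropositionalEquality using (_≡_; refl; cong; cong₂; sym; trans; module ≡-Reasoning)
open import Relation.Binary.Bundles using (Poset)
open import Relation.Binary.Structures using (IsTotalOrder)
import Relation.Binary.Reasoning.Setoid
import Relation.Binary.Reasoning.PartialOrder

-- Write t(I) = (-1)^{|I|} ∏_{v∈I} p_v for independent I.
-- (1) Inversion: Λ(S) = Σ_{J ⊆ V∖S} σ(J).  Expanding σ and exchanging the sums,
--     the coefficient of t(I) is Σ_{J ⊆ I, J ∩ S = ∅} (-1)^{|J|}, which is 1 if
--     I ⊆ S and 0 otherwise (alternating sum over the subsets of I ∖ S).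
--     Hence if all σ(J) ≥ 0, then Λ(S) ≥ 0 and Λ is antitone in S, so
--     Λ(S) ≤ Λ(∅) = 1.
-- (2) Vertex recursion: for v ∉ S and R = {u ∈ S : u ≁ v},
--     Λ(S ∪ {v}) = Λ(S) - p_v Λ(R), because the independent subsets of S ∪ {v}
--     containing v are exactly the sets I ∪ {v} with I an independent subset
--     of R.  Applied to S = D_v (so R = F_v), nonnegativity of Λ(D_v ∪ {v})
--     gives p_v Λ(F_v) ≤ Λ(D_v).

witness : ∀ {a} {A : Set a} (A? : Dec A) → does A? ≡ true → A
witness (yes a) _ = a

_⊆ᵇ_ : ∀ {n} → Subset n → Subset n → Bool
I ⊆ᵇ S = does (I ⊆? S)

insert : ∀ {n} → Fin n → Subset n → Subset n
insert v I = I [ v ]≔ inside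

∈-insert-self : ∀ {n} (v : Fin n) (I : Subset n) → v ∈ insert v I
∈-insert-self zero    (x ∷ I) = here
∈-insert-self (suc v) (x ∷ I) = there (∈-insert-self v I)

∈-insert⁺ : ∀ {n} {u : Fin n} (v : Fin n) (I : Subset n) → u ∈ I → u ∈ insert v I
∈-insert⁺ zero    (x ∷ I) here       = here
∈-insert⁺ zero    (x ∷ I) (there e)  = there e
∈-insert⁺ (suc v) (x ∷ I) here       = here
∈-insert⁺ (suc v) (x ∷ I) (there e)  = there (∈-insert⁺ v I e)

∈-insert⁻ : ∀ {n} {u : Fin n} (v : Fin n) (I : Subset n) → u ∈ insert v I → u ≡ v ⊎ u ∈ I
∈-insert⁻ zero    (x ∷ I) here      = inj₁ refl
∈-insert⁻ zero    (x ∷ I) (there e) = inj₂ (there e)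
∈-insert⁻ (suc v) (x ∷ I) here      = inj₂ here
∈-insert⁻ (suc v) (x ∷ I) (there e) with ∈-insert⁻ v I e
... | inj₁ u≡v = inj₁ (cong suc u≡v)
... | inj₂ u∈I = inj₂ (there u∈I)

∈-insert-avoiding : ∀ {n} {u : Fin n} {v I} (S : Subset n) →
                    v ∉ I → u ∈ I → u ∈ insert v S → u ∈ S
∈-insert-avoiding {v = v} S v∉I u∈I u∈S+v with ∈-insert⁻ v S u∈S+v
... | inj₁ refl = contradiction u∈I v∉I
... | inj₂ u∈S  = u∈S

⊆-insert⇔ : ∀ {n} {v : Fin n} {I S} → v ∉ I → I ⊆ insert v S ⇔ I ⊆ S
⊆-insert⇔ {v = v} {S = S} v∉I =
  mk⇔ (λ I⊆S+v {u} u∈I → ∈-insert-avoiding S v∉I u∈I (I⊆S+v u∈I))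
      (λ I⊆S {u} u∈I → ∈-insert⁺ v S (I⊆S u∈I))

insert-⊆-insert⇔ : ∀ {n} {v : Fin n} {I S} → v ∉ I → insert v I ⊆ insert v S ⇔ I ⊆ S
insert-⊆-insert⇔ {v = v} {I} {S} v∉I = mk⇔ to from
  where
    to : insert v I ⊆ insert v S → I ⊆ S
    to h {u} u∈I = ∈-insert-avoiding S v∉I u∈I (h (∈-insert⁺ v I u∈I))
    from : I ⊆ S → insert v I ⊆ insert v S
    from I⊆S {u} u∈I+v with ∈-insert⁻ v I u∈I+v
    ... | inj₁ refl = ∈-insert-self v S
    ... | inj₂ u∈I  = ∈-insert⁺ v S (I⊆S u∈I)

∣insert∣ : ∀ {n} (v : Fin n) (I : Subset n) → v ∉ I → ∣ insert v I ∣ ≡ suc ∣ I ∣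
∣insert∣ zero    (inside ∷ I)  v∉I = contradiction here v∉I
∣insert∣ zero    (outside ∷ I) _   = refl
∣insert∣ (suc v) (inside ∷ I)  v∉I = cong suc (∣insert∣ v I (v∉I ∘ there))
∣insert∣ (suc v) (outside ∷ I) v∉I = ∣insert∣ v I (v∉I ∘ there)

∈-tabulate⇔ : ∀ {n} (f : Fin n → Bool) {u} → u ∈ tabulate f ⇔ f u ≡ true
∈-tabulate⇔ f {u} =
  mk⇔ (λ u∈ → trans (sym (lookup∘tabulate f u)) ([]=⇒lookup u∈))
      (λ fu → lookup⇒[]= u (tabulate f) (trans (lookup∘tabulate f u) fu))

∧-not⇔ : ∀ {a b} → a ∧ not b ≡ true ⇔ (a ≡ true × b ≡ false)
∧-not⇔ {true}  {false} = mk⇔ (λ _ → refl , refl) (λ _ → refl)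
∧-not⇔ {true}  {true}  = mk⇔ (λ ()) (λ { (_ , ()) })
∧-not⇔ {false} {_}     = mk⇔ (λ ()) (λ { (() , _) })

v∉D : ∀ {n} (T : TreeOrder n) (v : Fin n) → v ∉ D T v
v∉D T v v∈D = contradiction lt-vv (λ ())
  where
    open TreeOrder T using (le; lt)
    v≟v : isYes (v ≟ᶠ v) ≡ true
    v≟v = trans (isYes≗does (v ≟ᶠ v)) (dec-true (v ≟ᶠ v) refl)
    lt-vv : false ≡ true
    lt-vv = begin
      false                           ≡⟨ sym (∧-zeroʳ (le v v)) ⟩
      le v v ∧ not true               ≡⟨ cong (λ b → le v v ∧ not b) (sym v≟v) ⟩
      le v v ∧ not (isYes (v ≟ᶠ v))   ≡⟨ Equivalence.to (∈-tabulate⇔ (λ u → lt u v)) v∈D ⟩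
      true                            ∎
      where open ≡-Reasoning

module _ {n} (G : Graph n) where
  open Graph G

  NonNeighbours : Fin n → Subset n → Subset n → Set
  NonNeighbours v S R = ∀ {u} → u ∈ R ⇔ (u ∈ S × adj u v ≡ false)

  F-nonNeighbours : (T : TreeOrder n) (v : Fin n) → NonNeighbours v (D T v) (F G T v)
  F-nonNeighbours T v {u} = mk⇔
    (λ u∈F → let (lt , nadj) = Equivalence.to ∧-not⇔ (F⇔ .Equivalence.to u∈F)
             in Equivalence.from (D⇔ u) lt , nadj)
    (λ (u∈D , nadj) → F⇔ .Equivalence.from
                         (Equivalence.from ∧-not⇔ (D⇔ u .Equivalence.to u∈D , nadj)))
    where
      open TreeOrder T using (lt)
      D⇔ : ∀ u → u ∈ D T v ⇔ lt u v ≡ true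
      D⇔ u = ∈-tabulate⇔ (λ w → lt w v)
      F⇔ : u ∈ F G T v ⇔ (lt u v ∧ not (adj u v)) ≡ true
      F⇔ = ∈-tabulate⇔ (λ w → lt w v ∧ not (adj w v))

  independent-⊥ : Independent G ⊥
  independent-⊥ _ _ u∈⊥ _ = contradiction u∈⊥ ∉⊥

  independent-insert⇔ : (v : Fin n) (I : Subset n) →
    Independent G (insert v I) ⇔ (Independent G I × (∀ {u} → u ∈ I → adj u v ≡ false))
  independent-insert⇔ v I = mk⇔ to from
    where
      to : Independent G (insert v I) → Independent G I × (∀ {u} → u ∈ I → adj u v ≡ false)
      to h = (λ a b a∈ b∈ → h a b (∈-insert⁺ v I a∈) (∈-insert⁺ v I b∈))
           , (λ {u} u∈ → h u v (∈-insert⁺ v I u∈) (∈-insert-self v I))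
      from : Independent G I × (∀ {u} → u ∈ I → adj u v ≡ false) → Independent G (insert v I)
      from (indI , nadj) a b a∈ b∈ with ∈-insert⁻ v I a∈ | ∈-insert⁻ v I b∈
      ... | inj₁ refl | inj₁ refl = adj-irr v
      ... | inj₁ refl | inj₂ b∈I  = trans (adj-sym v b) (nadj b∈I)
      ... | inj₂ a∈I  | inj₁ refl = nadj a∈I
      ... | inj₂ a∈I  | inj₂ b∈I  = indI a b a∈I b∈I

  insert-independent⇔ : ∀ {v I S R} → v ∉ I → NonNeighbours v S R →
    (insert v I ⊆ insert v S × Independent G (insert v I)) ⇔ (I ⊆ R × Independent G I)
  insert-independent⇔ {v} {I} {S} {R} v∉I R⇔ = mk⇔ to from
    where
      to : insert v I ⊆ insert v S × Independent G (insert v I) → I ⊆ R × Independent G I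
      to (I+v⊆S+v , ind) =
        let (indI , nadj) = Equivalence.to (independent-insert⇔ v I) ind
            I⊆S = Equivalence.to (insert-⊆-insert⇔ v∉I) I+v⊆S+v
        in (λ u∈I → Equivalence.from R⇔ (I⊆S u∈I , nadj u∈I)) , indI
      from : I ⊆ R × Independent G I → insert v I ⊆ insert v S × Independent G (insert v I)
      from (I⊆R , indI) =
          Equivalence.from (insert-⊆-insert⇔ v∉I) (λ u∈I → proj₁ (Equivalence.to R⇔ (I⊆R u∈I)))
        , Equivalence.from (independent-insert⇔ v I)
            (indI , λ u∈I → proj₂ (Equivalence.to R⇔ (I⊆R u∈I)))

module OverField {c ℓ₁ ℓ₂} (K : OrderedField c ℓ₁ ℓ₂) where
  open OrderedField K hiding (zero)
    renaming (refl to ≈-refl; sym to ≈-sym; trans to ≈-trans; reflexive to ≈-reflexive)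
  open WithField K
  open import Algebra.Properties.Ring ring using (-‿distribˡ-*; -‿distribʳ-*; -‿involutive; -0#≈0#; +-inverseˡ-unique)
  open import Algebra.Properties.CommutativeSemigroup +-commutativeSemigroup using (interchange)
  open import Algebra.Properties.CommutativeSemigroup *-commutativeSemigroup using (x∙yz≈y∙xz)
  open IsTotalOrder isTotalOrder using (isPartialOrder)
    renaming (refl to ≤-refl; trans to ≤-trans; reflexive to ≤-reflexive)

  poset : Poset c ℓ₁ ℓ₂
  poset = record { isPartialOrder = isPartialOrder }

  module ≈-Reasoning = Relation.Binary.Reasoning.Setoid setoid
  module ≤-Reasoning = Relation.Binary.Reasoning.PartialOrder poset

  sign : ℕ → Carrier
  sign = negOnePow

  sumOver : {A : Set} → (A → Carrier) → List A → Carrier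
  sumOver f xs = ∑ (map f xs)

  sumOver-cong : ∀ {A : Set} {f g : A → Carrier} (xs : List A) →
                 (∀ x → f x ≈ g x) → sumOver f xs ≈ sumOver g xs
  sumOver-cong []       f≈g = ≈-refl
  sumOver-cong (x ∷ xs) f≈g = +-cong (f≈g x) (sumOver-cong xs f≈g)

  sumOver-zero : ∀ {A : Set} (xs : List A) → sumOver (λ _ → 0#) xs ≈ 0#
  sumOver-zero []       = ≈-refl
  sumOver-zero (x ∷ xs) = ≈-trans (+-identityˡ _) (sumOver-zero xs)

  sumOver-+ : ∀ {A : Set} (f g : A → Carrier) (xs : List A) →
              sumOver (λ x → f x + g x) xs ≈ sumOver f xs + sumOver g xs
  sumOver-+ f g []       = ≈-sym (+-identityˡ 0#)
  sumOver-+ f g (x ∷ xs) =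
    ≈-trans (+-congˡ (sumOver-+ f g xs)) (interchange (f x) (g x) _ _)

  sumOver-*ˡ : ∀ {A : Set} (k : Carrier) (f : A → Carrier) (xs : List A) →
               sumOver (λ x → k * f x) xs ≈ k * sumOver f xs
  sumOver-*ˡ k f []       = ≈-sym (zeroʳ k)
  sumOver-*ˡ k f (x ∷ xs) = ≈-trans (+-congˡ (sumOver-*ˡ k f xs)) (≈-sym (distribˡ k _ _))

  sumOver-neg : ∀ {A : Set} (f : A → Carrier) (xs : List A) →
                sumOver (λ x → - f x) xs ≈ - sumOver f xs
  sumOver-neg f xs = +-inverseˡ-unique _ _ (begin
      sumOver (λ x → - f x) xs + sumOver f xs  ≈⟨ ≈-sym (sumOver-+ (λ x → - f x) f xs) ⟩
      sumOver (λ x → - f x + f x) xs           ≈⟨ sumOver-cong xs (λ x → -‿inverseˡ (f x)) ⟩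
      sumOver (λ _ → 0#) xs                    ≈⟨ sumOver-zero xs ⟩
      0#                                       ∎)
    where open ≈-Reasoning

  sumOver-++ : ∀ {A : Set} (f : A → Carrier) (xs ys : List A) →
               sumOver f (xs ++ ys) ≈ sumOver f xs + sumOver f ys
  sumOver-++ f []       ys = ≈-sym (+-identityˡ _)
  sumOver-++ f (x ∷ xs) ys = ≈-trans (+-congˡ (sumOver-++ f xs ys)) (≈-sym (+-assoc _ _ _))

  sumOver-map : ∀ {A B : Set} (f : A → Carrier) (g : B → A) (xs : List B) →
                sumOver f (map g xs) ≡ sumOver (f ∘ g) xs
  sumOver-map f g []       = refl
  sumOver-map f g (x ∷ xs) = cong (f (g x) +_) (sumOver-map f g xs)

  sumOver-swap : ∀ {A B : Set} (h : A → B → Carrier) (xs : List A) (ys : List B) →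
                 sumOver (λ x → sumOver (h x) ys) xs ≈ sumOver (λ y → sumOver (λ x → h x y) xs) ys
  sumOver-swap h []       ys = ≈-sym (sumOver-zero ys)
  sumOver-swap h (x ∷ xs) ys =
    ≈-trans (+-congˡ (sumOver-swap h xs ys)) (≈-sym (sumOver-+ (h x) _ ys))

  sumOver-mono : ∀ {A : Set} {f g : A → Carrier} (xs : List A) →
                 (∀ x → f x ≤ g x) → sumOver f xs ≤ sumOver g xs
  sumOver-mono []       f≤g = ≤-refl
  sumOver-mono (x ∷ xs) f≤g = +-mono (f≤g x) (sumOver-mono xs f≤g)
    where
      +-mono : ∀ {a b c d} → a ≤ b → c ≤ d → a + c ≤ b + d
      +-mono {a} {b} {c} {d} a≤b c≤d = begin
        a + c  ≤⟨ +-mono-≤ c a≤b ⟩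
        b + c  ≈⟨ +-comm b c ⟩
        c + b  ≤⟨ +-mono-≤ b c≤d ⟩
        d + b  ≈⟨ +-comm d b ⟩
        b + d  ∎
        where open ≤-Reasoning

  sumOver-nonneg : ∀ {A : Set} {f : A → Carrier} (xs : List A) →
                   (∀ x → 0# ≤ f x) → 0# ≤ sumOver f xs
  sumOver-nonneg xs 0≤f = ≤-trans (≤-reflexive (≈-sym (sumOver-zero xs))) (sumOver-mono xs 0≤f)

  infix 8 [_]_
  [_]_ : Bool → Carrier → Carrier
  [ b ] x = if b then x else 0#

  []-cong : ∀ b {x y} → x ≈ y → [ b ] x ≈ [ b ] y
  []-cong true  x≈y = x≈y
  []-cong false x≈y = ≈-refl

  []-neg-*ˡ : ∀ b k x → [ b ] (- (k * x)) ≈ - (k * [ b ] x)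
  []-neg-*ˡ true  k x = ≈-refl
  []-neg-*ˡ false k x = ≈-sym (≈-trans (-‿cong (zeroʳ k)) -0#≈0#)

  []-∧ : ∀ a b x → [ a ∧ b ] x ≈ [ a ] [ b ] x
  []-∧ true  b x = ≈-refl
  []-∧ false b x = ≈-refl

  []-sumOver : ∀ {A : Set} b (f : A → Carrier) (xs : List A) →
               [ b ] sumOver f xs ≈ sumOver (λ x → [ b ] f x) xs
  []-sumOver true  f xs = ≈-refl
  []-sumOver false f xs = ≈-sym (sumOver-zero xs)

  []-nonneg : ∀ b {x} → 0# ≤ x → 0# ≤ [ b ] x
  []-nonneg true  0≤x = 0≤x
  []-nonneg false 0≤x = ≤-refl

  []-mono : ∀ {a b x} → (a ≡ true → b ≡ true) → 0# ≤ x → [ a ] x ≤ [ b ] x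
  []-mono {true}          a⇒b 0≤x with a⇒b refl
  ... | refl = ≤-refl
  []-mono {false} {b} a⇒b 0≤x = []-nonneg b 0≤x

  sumOver-filter : ∀ {A : Set} {ℓ} {Q : A → Set ℓ} (Q? : ∀ x → Dec (Q x)) (f : A → Carrier)
                   (xs : List A) → sumOver f (filter Q? xs) ≈ sumOver (λ x → [ does (Q? x) ] f x) xs
  sumOver-filter Q? f []       = ≈-refl
  sumOver-filter Q? f (x ∷ xs) with does (Q? x)
  ... | true  = +-congˡ (sumOver-filter Q? f xs)
  ... | false = ≈-trans (sumOver-filter Q? f xs) (≈-sym (+-identityˡ _))

  Σₛ : (n : ℕ) → (Subset n → Carrier) → Carrier
  Σₛ n f = sumOver f (allSubsets n)

  Σₛ-cong : ∀ n {f g : Subset n → Carrier} → (∀ I → f I ≈ g I) → Σₛ n f ≈ Σₛ n g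
  Σₛ-cong n = sumOver-cong (allSubsets n)

  Σₛ-suc : ∀ n (f : Subset (suc n) → Carrier) →
           Σₛ (suc n) f ≈ Σₛ n (λ I → f (outside ∷ I)) + Σₛ n (λ I → f (inside ∷ I))
  Σₛ-suc n f = begin
      sumOver f (outs ++ ins)          ≈⟨ sumOver-++ f outs ins ⟩
      sumOver f outs + sumOver f ins   ≡⟨ cong₂ _+_ (sumOver-map f (outside ∷_) (allSubsets n))
                                                    (sumOver-map f (inside ∷_) (allSubsets n)) ⟩
      Σₛ n (λ I → f (outside ∷ I)) + Σₛ n (λ I → f (inside ∷ I)) ∎
    where
      open ≈-Reasoning
      outs ins : List (Subset (suc n))
      outs = map (outside ∷_) (allSubsets n)
      ins  = map (inside ∷_) (allSubsets n)

  Σₛ-⊆⊥ : ∀ n (h : Subset n → Carrier) → Σₛ n (λ I → [ I ⊆ᵇ ⊥ ] h I) ≈ h ⊥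
  Σₛ-⊆⊥ zero    h = +-identityʳ _
  Σₛ-⊆⊥ (suc n) h = begin
      Σₛ (suc n) (λ I → [ I ⊆ᵇ ⊥ ] h I)                  ≈⟨ Σₛ-suc n _ ⟩
      Σₛ n (λ I → [ I ⊆ᵇ ⊥ ] h (outside ∷ I)) + Σₛ n (λ _ → 0#)
                                                        ≈⟨ +-cong (Σₛ-⊆⊥ n _) (sumOver-zero (allSubsets n)) ⟩
      h ⊥ + 0#                                          ≈⟨ +-identityʳ _ ⟩
      h ⊥                                               ∎
    where open ≈-Reasoning

  Σₛ-split : ∀ {n} (v : Fin n) (f : Subset n → Carrier) →
             Σₛ n f ≈ Σₛ n (λ I → [ not (does (v ∈? I)) ] (f I + f (insert v I)))
  Σₛ-split {suc n} zero f = begin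
      Σₛ (suc n) f                                                  ≈⟨ Σₛ-suc n f ⟩
      Σₛ n (λ I → f (outside ∷ I)) + Σₛ n (λ I → f (inside ∷ I))    ≈⟨ ≈-sym (sumOver-+ _ _ (allSubsets n)) ⟩
      Σₛ n (λ I → f (outside ∷ I) + f (inside ∷ I))                 ≈⟨ ≈-sym (+-identityʳ _) ⟩
      Σₛ n (λ I → f (outside ∷ I) + f (inside ∷ I)) + 0#            ≈⟨ +-congˡ (≈-sym (sumOver-zero (allSubsets n))) ⟩
      Σₛ n (λ I → f (outside ∷ I) + f (inside ∷ I)) + Σₛ n (λ _ → 0#) ≈⟨ ≈-sym (Σₛ-suc n _) ⟩
      Σₛ (suc n) (λ I → [ not (does (zero ∈? I)) ] (f I + f (insert zero I))) ∎
    where open ≈-Reasoning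
  Σₛ-split {suc n} (suc v) f = begin
      Σₛ (suc n) f                                                 ≈⟨ Σₛ-suc n f ⟩
      Σₛ n (λ I → f (outside ∷ I)) + Σₛ n (λ I → f (inside ∷ I))   ≈⟨ +-cong (Σₛ-split v _) (Σₛ-split v _) ⟩
      _                                                            ≈⟨ ≈-sym (Σₛ-suc n _) ⟩
      Σₛ (suc n) (λ I → [ not (does (suc v ∈? I)) ] (f I + f (insert (suc v) I))) ∎
    where open ≈-Reasoning

  []-neg : ∀ b x → [ b ] (- x) ≈ - [ b ] x
  []-neg true  x = ≈-refl
  []-neg false x = ≈-sym -0#≈0#

  -- Σ_{J ⊆ I, J ∩ S = ∅} (-1)^{|J|} = [ I ⊆ S ]: an alternating sum over all
  -- subsets of I ∖ S, which vanishes unless I ∖ S is empty.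
  alternating : ∀ n (I S : Subset n) →
    Σₛ n (λ J → [ J ⊆ᵇ I ∧ J ⊆ᵇ ∁ S ] sign ∣ J ∣) ≈ [ I ⊆ᵇ S ] 1#
  alternating zero    []            []            = +-identityʳ 1#
  alternating (suc n) (outside ∷ I) (s ∷ S)       = begin
      Σₛ (suc n) _  ≈⟨ Σₛ-suc n _ ⟩
      Σₛ n (λ J → [ J ⊆ᵇ I ∧ J ⊆ᵇ ∁ S ] sign ∣ J ∣) + Σₛ n (λ _ → 0#)
                     ≈⟨ +-cong (alternating n I S) (sumOver-zero (allSubsets n)) ⟩
      [ I ⊆ᵇ S ] 1# + 0#  ≈⟨ +-identityʳ _ ⟩
      [ I ⊆ᵇ S ] 1#       ∎
    where open ≈-Reasoning
  alternating (suc n) (inside ∷ I)  (inside ∷ S)  = begin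
      Σₛ (suc n) _  ≈⟨ Σₛ-suc n _ ⟩
      Σₛ n (λ J → [ J ⊆ᵇ I ∧ J ⊆ᵇ ∁ S ] sign ∣ J ∣)
        + Σₛ n (λ J → [ J ⊆ᵇ I ∧ false ] (- sign ∣ J ∣))
                     ≈⟨ +-cong (alternating n I S) (Σₛ-cong n λ J →
                          ≈-reflexive (cong (λ b → [ b ] (- sign ∣ J ∣)) (∧-zeroʳ (J ⊆ᵇ I)))) ⟩
      [ I ⊆ᵇ S ] 1# + Σₛ n (λ _ → 0#)  ≈⟨ +-congˡ (sumOver-zero (allSubsets n)) ⟩
      [ I ⊆ᵇ S ] 1# + 0#               ≈⟨ +-identityʳ _ ⟩
      [ I ⊆ᵇ S ] 1#                    ∎
    where open ≈-Reasoning
  alternating (suc n) (inside ∷ I)  (outside ∷ S) = begin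
      Σₛ (suc n) _  ≈⟨ Σₛ-suc n _ ⟩
      Σₛ n E + Σₛ n (λ J → [ J ⊆ᵇ I ∧ J ⊆ᵇ ∁ S ] (- sign ∣ J ∣))
                     ≈⟨ +-congˡ (Σₛ-cong n (λ J → []-neg (J ⊆ᵇ I ∧ J ⊆ᵇ ∁ S) _)) ⟩
      Σₛ n E + Σₛ n (λ J → - E J)  ≈⟨ +-congˡ (sumOver-neg E (allSubsets n)) ⟩
      Σₛ n E + - Σₛ n E            ≈⟨ -‿inverseʳ _ ⟩
      0#                           ∎
    where
      open ≈-Reasoning
      E : Subset n → Carrier
      E J = [ J ⊆ᵇ I ∧ J ⊆ᵇ ∁ S ] sign ∣ J ∣

  sign-∸ : ∀ a b → b Nat.≤ a → sign (a ∸ b) ≈ sign a * sign b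
  sign-∸ a       zero    _           = ≈-sym (*-identityʳ _)
  sign-∸ (suc a) (suc b) (Nat.s≤s b≤a) = begin
      sign (a ∸ b)             ≈⟨ sign-∸ a b b≤a ⟩
      sign a * sign b          ≈⟨ ≈-sym (-‿involutive _) ⟩
      - - (sign a * sign b)    ≈⟨ -‿cong (-‿distribˡ-* _ _) ⟩
      - (- sign a * sign b)    ≈⟨ -‿distribʳ-* _ _ ⟩
      - sign a * - sign b      ∎
    where open ≈-Reasoning

  -- The summand of Σ_J [J ∩ S = ∅] σ(J) indexed by (J, I) factors into a part
  -- depending on I only and the summand of the alternating sum above.
  factor-summand : ∀ (s d i : Bool) (a b : ℕ) (q : Carrier) → (s ≡ true → b Nat.≤ a) →
    [ d ] [ s ∧ i ] (sign (a ∸ b) * q) ≈ [ i ] (sign a * q) * [ s ∧ d ] sign b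
  factor-summand false d     i     a b q _   = ≈-trans ([]-cong d ≈-refl) (lemma d)
    where
      lemma : ∀ d → [ d ] 0# ≈ [ i ] (sign a * q) * 0#
      lemma true  = ≈-sym (zeroʳ _)
      lemma false = ≈-sym (zeroʳ _)
  factor-summand true  false i     a b q _   = ≈-sym (zeroʳ _)
  factor-summand true  true  false a b q _   = ≈-sym (zeroˡ _)
  factor-summand true  true  true  a b q b≤a = begin
      sign (a ∸ b) * q        ≈⟨ *-congʳ (sign-∸ a b (b≤a refl)) ⟩
      (sign a * sign b) * q   ≈⟨ *-assoc _ _ _ ⟩
      sign a * (sign b * q)   ≈⟨ *-congˡ (*-comm _ _) ⟩
      sign a * (q * sign b)   ≈⟨ ≈-sym (*-assoc _ _ _) ⟩
      (sign a * q) * sign b   ∎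
    where open ≈-Reasoning

  []-*-[]1 : ∀ i s x → [ i ] x * [ s ] 1# ≈ [ s ∧ i ] x
  []-*-[]1 i false x = zeroʳ _
  []-*-[]1 i true  x = *-identityʳ _

  ∏-⊥ : ∀ n (q : Fin n → Carrier) → ∏ q ⊥ ≈ 1#
  ∏-⊥ zero    q = ≈-refl
  ∏-⊥ (suc n) q = ∏-⊥ n (q ∘ suc)

  ∏-insert : ∀ {n} (q : Fin n → Carrier) (v : Fin n) (I : Subset n) → v ∉ I →
             ∏ q (insert v I) ≈ q v * ∏ q I
  ∏-insert q zero    (inside ∷ I)  v∉I = contradiction here v∉I
  ∏-insert q zero    (outside ∷ I) _   = ≈-refl
  ∏-insert q (suc v) (outside ∷ I) v∉I = ∏-insert (q ∘ suc) v I (v∉I ∘ there)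
  ∏-insert q (suc v) (inside ∷ I)  v∉I =
    ≈-trans (*-congˡ (∏-insert (q ∘ suc) v I (v∉I ∘ there))) (x∙yz≈y∙xz _ _ _)

  ≤-from-difference : ∀ {x y} → 0# ≤ y - x → x ≤ y
  ≤-from-difference {x} {y} 0≤y-x = begin
      x             ≈⟨ ≈-sym (+-identityˡ x) ⟩
      0# + x        ≤⟨ +-mono-≤ x 0≤y-x ⟩
      (y - x) + x   ≈⟨ +-assoc _ _ _ ⟩
      y + (- x + x) ≈⟨ +-congˡ (-‿inverseˡ x) ⟩
      y + 0#        ≈⟨ +-identityʳ y ⟩
      y             ∎
    where open ≤-Reasoning

  module _ {n} (G : Graph n) (p : Fin n → Carrier) where

    independentᵇ : Subset n → Bool
    independentᵇ I = does (independent? G I)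

    weight : Subset n → Carrier
    weight I = sign ∣ I ∣ * ∏ p I

    Λ-as-sum : ∀ S → Λ G p S ≈ Σₛ n (λ I → [ I ⊆ᵇ S ∧ independentᵇ I ] weight I)
    Λ-as-sum S = sumOver-filter (λ I → (I ⊆? S) ×-dec independent? G I) weight (allSubsets n)

    σ-as-sum : ∀ J → σ G p J ≈
               Σₛ n (λ I → [ J ⊆ᵇ I ∧ independentᵇ I ] (sign (∣ I ∣ ∸ ∣ J ∣) * ∏ p I))
    σ-as-sum J = sumOver-filter (λ I → (J ⊆? I) ×-dec independent? G I) _ (allSubsets n)

    Λ-inversion : ∀ S → Λ G p S ≈ Σₛ n (λ J → [ J ⊆ᵇ ∁ S ] σ G p J)
    Λ-inversion S = ≈-sym (begin
        Σₛ n (λ J → [ J ⊆ᵇ ∁ S ] σ G p J)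
          ≈⟨ Σₛ-cong n (λ J → []-cong (J ⊆ᵇ ∁ S) (σ-as-sum J)) ⟩
        Σₛ n (λ J → [ J ⊆ᵇ ∁ S ] Σₛ n (σ-term J))
          ≈⟨ Σₛ-cong n (λ J → []-sumOver (J ⊆ᵇ ∁ S) (σ-term J) (allSubsets n)) ⟩
        Σₛ n (λ J → Σₛ n (λ I → [ J ⊆ᵇ ∁ S ] σ-term J I))
          ≈⟨ Σₛ-cong n (λ J → Σₛ-cong n (λ I → factor-summand (J ⊆ᵇ I) (J ⊆ᵇ ∁ S)
               (independentᵇ I) ∣ I ∣ ∣ J ∣ (∏ p I) (p⊆q⇒∣p∣≤∣q∣ ∘ witness (J ⊆? I)))) ⟩
        Σₛ n (λ J → Σₛ n (λ I → Λ-term I * alt-term I J))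
          ≈⟨ sumOver-swap (λ J I → Λ-term I * alt-term I J) (allSubsets n) (allSubsets n) ⟩
        Σₛ n (λ I → Σₛ n (λ J → Λ-term I * alt-term I J))
          ≈⟨ Σₛ-cong n (λ I → sumOver-*ˡ (Λ-term I) (alt-term I) (allSubsets n)) ⟩
        Σₛ n (λ I → Λ-term I * Σₛ n (alt-term I))
          ≈⟨ Σₛ-cong n (λ I → *-congˡ (alternating n I S)) ⟩
        Σₛ n (λ I → Λ-term I * [ I ⊆ᵇ S ] 1#)
          ≈⟨ Σₛ-cong n (λ I → []-*-[]1 (independentᵇ I) (I ⊆ᵇ S) (weight I)) ⟩
        Σₛ n (λ I → [ I ⊆ᵇ S ∧ independentᵇ I ] weight I)
          ≈⟨ ≈-sym (Λ-as-sum S) ⟩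
        Λ G p S ∎)
      where
        open ≈-Reasoning
        σ-term : Subset n → Subset n → Carrier
        σ-term J I = [ J ⊆ᵇ I ∧ independentᵇ I ] (sign (∣ I ∣ ∸ ∣ J ∣) * ∏ p I)
        Λ-term : Subset n → Carrier
        Λ-term I = [ independentᵇ I ] weight I
        alt-term : Subset n → Subset n → Carrier
        alt-term I J = [ J ⊆ᵇ I ∧ J ⊆ᵇ ∁ S ] sign ∣ J ∣

    Λ-⊥ : Λ G p ⊥ ≈ 1#
    Λ-⊥ = begin
        Λ G p ⊥                                                ≈⟨ Λ-as-sum ⊥ ⟩
        Σₛ n (λ I → [ I ⊆ᵇ ⊥ ∧ independentᵇ I ] weight I)      ≈⟨ Σₛ-cong n (λ I → []-∧ (I ⊆ᵇ ⊥) _ _) ⟩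
        Σₛ n (λ I → [ I ⊆ᵇ ⊥ ] [ independentᵇ I ] weight I)    ≈⟨ Σₛ-⊆⊥ n _ ⟩
        [ independentᵇ ⊥ ] weight ⊥                            ≡⟨ cong (λ b → [ b ] weight ⊥)
                                                                   (dec-true (independent? G ⊥) (independent-⊥ G)) ⟩
        sign ∣ ⊥ {n = n} ∣ * ∏ p ⊥                              ≡⟨ cong (λ k → sign k * ∏ p ⊥) (∣⊥∣≡0 n) ⟩
        1# * ∏ p ⊥                                             ≈⟨ *-identityˡ _ ⟩
        ∏ p ⊥                                                  ≈⟨ ∏-⊥ n p ⟩
        1#                                                     ∎
      where open ≈-Reasoning

    module _ (σ≥0 : ∀ J → 0# ≤ σ G p J) where

      Λ-nonneg : ∀ S → 0# ≤ Λ G p S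
      Λ-nonneg S = ≤-trans (sumOver-nonneg (allSubsets n) (λ J → []-nonneg (J ⊆ᵇ ∁ S) (σ≥0 J)))
                           (≤-reflexive (≈-sym (Λ-inversion S)))

      -- Λ is antitone: a larger S leaves fewer J disjoint from it.
      Λ-antitone : ∀ {S S′} → S ⊆ S′ → Λ G p S′ ≤ Λ G p S
      Λ-antitone {S} {S′} S⊆S′ = begin
          Λ G p S′                              ≈⟨ Λ-inversion S′ ⟩
          Σₛ n (λ J → [ J ⊆ᵇ ∁ S′ ] σ G p J)    ≤⟨ sumOver-mono (allSubsets n) (λ J → []-mono (shrink J) (σ≥0 J)) ⟩
          Σₛ n (λ J → [ J ⊆ᵇ ∁ S ] σ G p J)     ≈⟨ ≈-sym (Λ-inversion S) ⟩
          Λ G p S                               ∎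
        where
          open ≤-Reasoning
          shrink : ∀ J → J ⊆ᵇ ∁ S′ ≡ true → J ⊆ᵇ ∁ S ≡ true
          shrink J J⊆∁S′ = dec-true (J ⊆? ∁ S) λ u∈J →
            x∉p⇒x∈∁p (x∈∁p⇒x∉p (witness (J ⊆? ∁ S′) J⊆∁S′ u∈J) ∘ S⊆S′)

      Λ-≤1 : ∀ S → Λ G p S ≤ 1#
      Λ-≤1 S = ≤-trans (Λ-antitone ⊥⊆) (≤-reflexive Λ-⊥)

    weight-insert : ∀ {v} I → v ∉ I → weight (insert v I) ≈ - (p v * weight I)
    weight-insert {v} I v∉I = begin
        sign ∣ insert v I ∣ * ∏ p (insert v I) ≡⟨ cong (λ k → sign k * ∏ p (insert v I)) (∣insert∣ v I v∉I) ⟩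
        - sign ∣ I ∣ * ∏ p (insert v I)        ≈⟨ *-congˡ (∏-insert p v I v∉I) ⟩
        - sign ∣ I ∣ * (p v * ∏ p I)           ≈⟨ ≈-sym (-‿distribˡ-* _ _) ⟩
        - (sign ∣ I ∣ * (p v * ∏ p I))         ≈⟨ -‿cong (x∙yz≈y∙xz _ _ _) ⟩
        - (p v * weight I)                     ∎
      where open ≈-Reasoning

    -- The independent subsets of S ∪ {v} are those of S together with the sets
    -- I ∪ {v}, I an independent subset of R.
    Λ-insert : ∀ {v S R} → v ∉ S → NonNeighbours G v S R →
               Λ G p (insert v S) ≈ Λ G p S - p v * Λ G p R
    Λ-insert {v} {S} {R} v∉S R⇔ = begin
        Λ G p (insert v S)                                   ≈⟨ Λ-as-sum (insert v S) ⟩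
        Σₛ n (term (insert v S))                             ≈⟨ Σₛ-split v _ ⟩
        Σₛ n (λ I → [ not (does (v ∈? I)) ]
                      (term (insert v S) I + term (insert v S) (insert v I)))
                                                             ≈⟨ Σₛ-cong n paired ⟩
        Σₛ n (λ I → term S I - p v * term R I)               ≈⟨ sumOver-+ _ _ (allSubsets n) ⟩
        Σₛ n (term S) + Σₛ n (λ I → - (p v * term R I))      ≈⟨ +-congˡ (sumOver-neg _ (allSubsets n)) ⟩
        Σₛ n (term S) - Σₛ n (λ I → p v * term R I)          ≈⟨ +-congˡ (-‿cong (sumOver-*ˡ (p v) (term R) (allSubsets n))) ⟩
        Σₛ n (term S) - p v * Σₛ n (term R)                  ≈⟨ ≈-sym (+-cong (Λ-as-sum S) (-‿cong (*-congˡ (Λ-as-sum R)))) ⟩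
        Λ G p S - p v * Λ G p R                              ∎
      where
        open ≈-Reasoning
        term : Subset n → Subset n → Carrier
        term X I = [ I ⊆ᵇ X ∧ independentᵇ I ] weight I

        term-absent : ∀ {X I} → v ∉ X → v ∈ I → term X I ≈ 0#
        term-absent {X} {I} v∉X v∈I = ≈-reflexive (cong (λ b → [ b ∧ independentᵇ I ] weight I)
                                        (dec-false (I ⊆? X) (λ I⊆X → v∉X (I⊆X v∈I))))

        v∉R : v ∉ R
        v∉R v∈R = v∉S (proj₁ (Equivalence.to R⇔ v∈R))

        paired : ∀ I → [ not (does (v ∈? I)) ] (term (insert v S) I + term (insert v S) (insert v I))
                       ≈ term S I - p v * term R I
        paired I with v ∈? I
        ... | yes v∈I = ≈-sym (begin
            term S I - p v * term R I  ≈⟨ +-cong (term-absent v∉S v∈I) (-‿cong (*-congˡ (term-absent v∉R v∈I))) ⟩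
            0# - p v * 0#              ≈⟨ +-identityˡ _ ⟩
            - (p v * 0#)               ≈⟨ -‿cong (zeroʳ _) ⟩
            - 0#                       ≈⟨ -0#≈0# ⟩
            0#                         ∎)
        ... | no v∉I = +-cong
            (≈-reflexive (cong (λ b → [ b ∧ independentᵇ I ] weight I) (does-⇔ (⊆-insert⇔ v∉I) (I ⊆? insert v S) (I ⊆? S))))
            (begin
              term (insert v S) (insert v I)
                ≡⟨ cong (λ b → [ b ] weight (insert v I))
                     (does-⇔ (insert-independent⇔ G v∉I R⇔)
                       ((insert v I ⊆? insert v S) ×-dec independent? G (insert v I))
                       ((I ⊆? R) ×-dec independent? G I)) ⟩
              [ I ⊆ᵇ R ∧ independentᵇ I ] weight (insert v I)  ≈⟨ []-cong _ (weight-insert I v∉I) ⟩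
              [ I ⊆ᵇ R ∧ independentᵇ I ] (- (p v * weight I)) ≈⟨ []-neg-*ˡ _ _ _ ⟩
              - (p v * term R I)                                ∎)

    insert-bound : ∀ {v S R} → v ∉ S → NonNeighbours G v S R →
                   0# ≤ Λ G p (insert v S) → p v * Λ G p R ≤ Λ G p S
    insert-bound v∉S R⇔ 0≤Λ = ≤-from-difference (≤-trans 0≤Λ (≤-reflexive (Λ-insert v∉S R⇔)))

mainTheorem6 : ∀ {c ℓ₁ ℓ₂} (K : OrderedField c ℓ₁ ℓ₂) →
    let open OrderedField K
        open WithField K
    in (n : ℕ) (G : Graph n) (T : TreeOrder n) → Lefthanded G T →
       (p : Fin n → Carrier) → (∀ v → 0# ≤ p v × p v ≤ 1#) →
       (∀ (S : Subset n) → 0# ≤ σ G p S) →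
       (∀ (S : Subset n) → 0# ≤ Λ G p S × Λ G p S ≤ 1#)
       × (∀ (v : Fin n) → p v * Λ G p (F G T v) ≤ Λ G p (D T v))
mainTheorem6 K n G T _ p _ σ≥0 =
    (λ S → Λ-nonneg G p σ≥0 S , Λ-≤1 G p σ≥0 S)
  , (λ v → insert-bound G p (v∉D T v) (F-nonNeighbours G T v)
                        (Λ-nonneg G p σ≥0 (insert v (D T v))))
  where open OverField K
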